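{- (1) Small-step: if $t\to_{vsc}t'$ then $t\{x:=v\}\to_{vsc}t'\{x:=v\}$ for every value $v$. (2) Big-step: if $t\{x:=v\}\Downarrow_kn$ then there exist $k'$ and $n'$ such that $t\Downarrow_{k'}n'$ and $n'\{x:=v\}\Downarrow_{k-k'}n$.
   Context: VSC terms $t::=v\mid tu\mid t[x\leftarrow u]$, values $v::=x\mid\lambda x.t$ ($[x\leftarrow u]$ binds $x$; $t\{x:=v\}$ capture-avoiding substitution). Substitution contexts $L::=\langle\cdot\rangle\mid L[x\leftarrow t]$; evaluation contexts $E::=\langle\cdot\rangle\mid tE\mid Et\mid E[x\leftarrow u]\mid t[x\leftarrow E]$. $\to_{vsc}$ is the closure under $E$ of $L\langle\lambda x.t\rangle u\mapsto L\langle t[x\leftarrow u]\rangle$ and $t[x\leftarrow L\langle v\rangle]\mapsto L\langle t\{x:=v\}\rangle$. Grammars: $\mathbb{i}::=xf\mid\mathbb{i}f$; $i::=\mathbb{i}\mid i[x\leftarrow i']$; $f,n::=v\mid i\mid f[x\leftarrow i]$; $I::=\langle\cdot\rangle\mid I[x\leftarrow i]$. Big step $t\Downarrow_kf$: $v\Downarrow_0v$; $t\Downarrow_kI\langle\lambda x.s\rangle$, $s[x\leftarrow u]\Downarrow_if\Rightarrow tu\Downarrow_{k+i+1}I\langle f\rangle$; $t\Downarrow_kI\langle x\rangle$, $u\Downarrow_hf\Rightarrow tu\Downarrow_{k+h}I\langle xf\rangle$; $t\Downarrow_kI\langle\mathbb{i}\rangle$, $u\Downarrow_hf\Rightarrow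 tu\Downarrow_{k+h}I\langle\mathbb{i}f\rangle$; $u\Downarrow_kI\langle v\rangle$, $t\{x:=v\}\Downarrow_if\Rightarrow t[x\leftarrow u]\Downarrow_{k+i+1}I\langle f\rangle$; $t\Downarrow_kf$, $u\Downarrow_hi\Rightarrow t[x\leftarrow u]\Downarrow_{k+h}f[x\leftarrow i]$. -}

module Defs where

open import Data.Nat using (ℕ; zero; suc; _+_)
open import Data.Fin using (Fin; zero; suc)
open import Function using (id; _∘_)

-- Well-scoped de Bruijn VSC terms:  t ::= x | λx.t | t u | t[x←u]
-- (es t u) is t[x←u]; x (index 0) is bound in t only.
data Term (n : ℕ) : Set where
  var : Fin n → Term n
  lam : Term (suc n) → Term n
  app : Term n → Term n → Term n
  es  : Term (suc n) → Term n → Term n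

data Value {n : ℕ} : Term n → Set where
  vvar : (x : Fin n) → Value (var x)
  vlam : (t : Term (suc n)) → Value (lam t)

ext : {n m : ℕ} → (Fin n → Fin m) → Fin (suc n) → Fin (suc m)
ext ρ zero    = zero
ext ρ (suc x) = suc (ρ x)

rename : {n m : ℕ} → (Fin n → Fin m) → Term n → Term m
rename ρ (var x)  = var (ρ x)
rename ρ (lam t)  = lam (rename (ext ρ) t)
rename ρ (app t u) = app (rename ρ t) (rename ρ u)
rename ρ (es t u) = es (rename (ext ρ) t) (rename ρ u)

exts : {n m : ℕ} → (Fin n → Term m) → Fin (suc n) → Term (suc m)
exts σ zero    = var zero
exts σ (suc x) = rename suc (σ x)

subst : {n m : ℕ} → (Fin n → Term m) → Term n → Term m
subst σ (var x)  = σ x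
subst σ (lam t)  = lam (subst (exts σ) t)
subst σ (app t u) = app (subst σ t) (subst σ u)
subst σ (es t u) = es (subst (exts σ) t) (subst σ u)

σ₀ : {n : ℕ} → Term n → Fin (suc n) → Term n
σ₀ v zero    = v
σ₀ v (suc x) = var x

_⟦_⟧ : {n : ℕ} → Term (suc n) → Term n → Term n
t ⟦ v ⟧ = subst (σ₀ v) t

-- Substitution contexts L ::= ⟨·⟩ | L[x←u].
-- SCtx n m : context with free variables in scope n whose hole is under
-- (m ∸ n) explicit-substitution binders.  (L ⟨[← u ]) is L[x←u].
data SCtx (n : ℕ) : ℕ → Set where
  hole  : SCtx n n
  _⟨[←_] : {m : ℕ} → SCtx (suc n) m → Term n → SCtx n m

plug : {n m : ℕ} → SCtx n m → Term m → Term n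
plug hole t        = t
plug (L ⟨[← u ]) t = es (plug L t) u

-- the renaming weakening a term across the binders of a context
-- (realises the variable convention: u is not captured by L)
wkρ : {n m : ℕ} → SCtx n m → Fin n → Fin m
wkρ hole        = id
wkρ (L ⟨[← u ]) = wkρ L ∘ suc

wk : {n m : ℕ} → SCtx n m → Term n → Term m
wk L = rename (wkρ L)

infix 4 _⟶_
data _⟶_ {n : ℕ} : Term n → Term n → Set where
  rule-m : {m : ℕ} (L : SCtx n m) (t : Term (suc m)) (u : Term n) →
           app (plug L (lam t)) u ⟶ plug L (es t (wk L u))
  rule-e : {m : ℕ} (t : Term (suc n)) (L : SCtx n m) (v : Term m) → Value v →
           es t (plug L v) ⟶ plug L ((rename (ext (wkρ L)) t) ⟦ v ⟧)
  ctx-appR : {t u u' : Term n} → u ⟶ u' → app t u ⟶ app t u'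
  ctx-appL : {t t' u : Term n} → t ⟶ t' → app t u ⟶ app t' u
  ctx-esL  : {t t' : Term (suc n)} {u : Term n} → t ⟶ t' → es t u ⟶ es t' u
  ctx-esR  : {t : Term (suc n)} {u u' : Term n} → u ⟶ u' → es t u ⟶ es t u'

data InertApp {n : ℕ} : Term n → Set
data Inert    {n : ℕ} : Term n → Set
data Fireball {n : ℕ} : Term n → Set

data InertApp {n} where
  ia-var : (x : Fin n) {f : Term n} → Fireball f → InertApp (app (var x) f)
  ia-app : {a f : Term n} → InertApp a → Fireball f → InertApp (app a f)

data Inert {n} where
  in-app : {a : Term n} → InertApp a → Inert a
  in-es  : {i : Term (suc n)} {i' : Term n} → Inert i → Inert i' → Inert (es i i')

data Fireball {n} where
  fb-val   : {v : Term n} → Value v → Fireball v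
  fb-inert : {i : Term n} → Inert i → Fireball i
  fb-es    : {f : Term (suc n)} {i : Term n} → Fireball f → Inert i → Fireball (es f i)

data InertCtx {n : ℕ} : {m : ℕ} → SCtx n m → Set where
  ic-hole : InertCtx hole
  ic-es   : {m : ℕ} {I : SCtx (suc n) m} {i : Term n} →
            InertCtx I → Inert i → InertCtx (I ⟨[← i ])

infix 4 _⇓[_]_
data _⇓[_]_ {n : ℕ} : Term n → ℕ → Term n → Set where
  bs-val : {v : Term n} → Value v → v ⇓[ 0 ] v
  bs-β   : {m k i : ℕ} {t u : Term n} {I : SCtx n m} {s : Term (suc m)} {f : Term m} →
           InertCtx I → t ⇓[ k ] plug I (lam s) → es s (wk I u) ⇓[ i ] f →
           app t u ⇓[ k + i + 1 ] plug I f
  bs-var : {m k h : ℕ} {t u f : Term n} {I : SCtx n m} {x : Fin m} →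
           InertCtx I → t ⇓[ k ] plug I (var x) → u ⇓[ h ] f →
           app t u ⇓[ k + h ] plug I (app (var x) (wk I f))
  bs-ia  : {m k h : ℕ} {t u f : Term n} {I : SCtx n m} {a : Term m} →
           InertCtx I → InertApp a → t ⇓[ k ] plug I a → u ⇓[ h ] f →
           app t u ⇓[ k + h ] plug I (app a (wk I f))
  bs-es  : {m k i : ℕ} {t : Term (suc n)} {u : Term n} {I : SCtx n m} {v f : Term m} →
           InertCtx I → Value v → u ⇓[ k ] plug I v →
           (rename (ext (wkρ I)) t) ⟦ v ⟧ ⇓[ i ] f →
           es t u ⇓[ k + i + 1 ] plug I f
  bs-esi : {k h : ℕ} {t f : Term (suc n)} {u i : Term n} →
           t ⇓[ k ] f → u ⇓[ h ] i → Inert i →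
           es t u ⇓[ k + h ] es f i

-- Both parts hold for any substitution σ of values, not only for {x:=v}.
-- (1) A value substitution maps values to values and substitution contexts to substitution
-- contexts, so both root rules are preserved, and so is the closure under evaluation contexts.
-- (2) We show that σ t ⇓ₖ nf factors as t ⇓ nf' followed by σ nf' ⇓ nf with the costs adding
-- up, by well-founded induction on the cost and, at equal cost, on t.  The subterms are
-- factorised first; since a fireball evaluates only to itself at cost 0, their evaluations can
-- be put in front of any evaluation of the rebuilt term.  What is left is a normal form whose
-- σ-instance may still fire: evaluating σ(J⟨h⟩) first runs through the context J, turning σ into
-- a value substitution τ under J, and the contractum is then factorised at strictly smaller cost.

module Submission where

open import Defs
open import Data.Nat using (ℕ; suc; _+_; _≤_; _<_; _∸_)
open import Data.Nat.Properties
  using (≤-refl; <⇒≤; m≤m+n; m+n≤o⇒m≤o; m+n≤o⇒n≤o; m+n∸m≡n; +-assoc; +-comm; +-suc; +-identityʳ)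
open import Data.Nat.Induction using (<-wellFounded)
open import Data.Nat.Tactic.RingSolver using (solve-∀)
open import Data.Fin using (Fin; zero; suc)
open import Data.Product using (Σ; _×_; _,_; ∃-syntax)
open import Data.Empty using (⊥; ⊥-elim)
open import Function using (id; _∘_)
open import Induction.WellFounded using (Acc; acc)
open import Relation.Binary.PropositionalEquality
  using (_≡_; _≗_; refl; sym; trans; cong; cong₂; module ≡-Reasoning) renaming (subst to ≡-subst)

-- Renaming and substitution

ext-cong : {n m : ℕ} {ρ ρ' : Fin n → Fin m} → ρ ≗ ρ' → ext ρ ≗ ext ρ'
ext-cong e zero    = refl
ext-cong e (suc x) = cong suc (e x)

rename-cong : {n m : ℕ} {ρ ρ' : Fin n → Fin m} → ρ ≗ ρ' → rename ρ ≗ rename ρ'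
rename-cong e (var x)   = cong var (e x)
rename-cong e (lam t)   = cong lam (rename-cong (ext-cong e) t)
rename-cong e (app t u) = cong₂ app (rename-cong e t) (rename-cong e u)
rename-cong e (es t u)  = cong₂ es (rename-cong (ext-cong e) t) (rename-cong e u)

ext-id : {n : ℕ} → ext {n} id ≗ id
ext-id zero    = refl
ext-id (suc x) = refl

rename-id : {n : ℕ} → rename {n} id ≗ id
rename-id (var x)   = refl
rename-id (lam t)   = cong lam (trans (rename-cong ext-id t) (rename-id t))
rename-id (app t u) = cong₂ app (rename-id t) (rename-id u)
rename-id (es t u)  = cong₂ es (trans (rename-cong ext-id t) (rename-id t)) (rename-id u)

ext-∘ : {n m k : ℕ} (ρ : Fin m → Fin k) (ρ' : Fin n → Fin m) → ext ρ ∘ ext ρ' ≗ ext (ρ ∘ ρ')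
ext-∘ ρ ρ' zero    = refl
ext-∘ ρ ρ' (suc x) = refl

rename-rename : {n m k : ℕ} (ρ : Fin m → Fin k) (ρ' : Fin n → Fin m) →
                rename ρ ∘ rename ρ' ≗ rename (ρ ∘ ρ')
rename-rename ρ ρ' (var x)   = refl
rename-rename ρ ρ' (lam t)   =
  cong lam (trans (rename-rename (ext ρ) (ext ρ') t) (rename-cong (ext-∘ ρ ρ') t))
rename-rename ρ ρ' (app t u) = cong₂ app (rename-rename ρ ρ' t) (rename-rename ρ ρ' u)
rename-rename ρ ρ' (es t u)  =
  cong₂ es (trans (rename-rename (ext ρ) (ext ρ') t) (rename-cong (ext-∘ ρ ρ') t))
           (rename-rename ρ ρ' u)

exts-cong : {n m : ℕ} {σ σ' : Fin n → Term m} → σ ≗ σ' → exts σ ≗ exts σ'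
exts-cong e zero    = refl
exts-cong e (suc x) = cong (rename suc) (e x)

subst-cong : {n m : ℕ} {σ σ' : Fin n → Term m} → σ ≗ σ' → subst σ ≗ subst σ'
subst-cong e (var x)   = e x
subst-cong e (lam t)   = cong lam (subst-cong (exts-cong e) t)
subst-cong e (app t u) = cong₂ app (subst-cong e t) (subst-cong e u)
subst-cong e (es t u)  = cong₂ es (subst-cong (exts-cong e) t) (subst-cong e u)

exts-ext : {n m k : ℕ} (σ : Fin m → Term k) (ρ : Fin n → Fin m) →
           exts σ ∘ ext ρ ≗ exts (σ ∘ ρ)
exts-ext σ ρ zero    = refl
exts-ext σ ρ (suc x) = refl

subst-rename : {n m k : ℕ} (σ : Fin m → Term k) (ρ : Fin n → Fin m) →
               subst σ ∘ rename ρ ≗ subst (σ ∘ ρ)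
subst-rename σ ρ (var x)   = refl
subst-rename σ ρ (lam t)   =
  cong lam (trans (subst-rename (exts σ) (ext ρ) t) (subst-cong (exts-ext σ ρ) t))
subst-rename σ ρ (app t u) = cong₂ app (subst-rename σ ρ t) (subst-rename σ ρ u)
subst-rename σ ρ (es t u)  =
  cong₂ es (trans (subst-rename (exts σ) (ext ρ) t) (subst-cong (exts-ext σ ρ) t))
           (subst-rename σ ρ u)

rename-exts : {n m k : ℕ} (ρ : Fin m → Fin k) (σ : Fin n → Term m) →
              rename (ext ρ) ∘ exts σ ≗ exts (rename ρ ∘ σ)
rename-exts ρ σ zero    = refl
rename-exts ρ σ (suc x) =
  trans (rename-rename (ext ρ) suc (σ x)) (sym (rename-rename suc ρ (σ x)))

rename-subst : {n m k : ℕ} (ρ : Fin m → Fin k) (σ : Fin n → Term m) →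
               rename ρ ∘ subst σ ≗ subst (rename ρ ∘ σ)
rename-subst ρ σ (var x)   = refl
rename-subst ρ σ (lam t)   =
  cong lam (trans (rename-subst (ext ρ) (exts σ) t) (subst-cong (rename-exts ρ σ) t))
rename-subst ρ σ (app t u) = cong₂ app (rename-subst ρ σ t) (rename-subst ρ σ u)
rename-subst ρ σ (es t u)  =
  cong₂ es (trans (rename-subst (ext ρ) (exts σ) t) (subst-cong (rename-exts ρ σ) t))
           (rename-subst ρ σ u)

subst-exts : {n m k : ℕ} (σ : Fin m → Term k) (τ : Fin n → Term m) →
             subst (exts σ) ∘ exts τ ≗ exts (subst σ ∘ τ)
subst-exts σ τ zero    = refl
subst-exts σ τ (suc x) =
  trans (subst-rename (exts σ) suc (τ x)) (sym (rename-subst suc σ (τ x)))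

subst-subst : {n m k : ℕ} (σ : Fin m → Term k) (τ : Fin n → Term m) →
              subst σ ∘ subst τ ≗ subst (subst σ ∘ τ)
subst-subst σ τ (var x)   = refl
subst-subst σ τ (lam t)   =
  cong lam (trans (subst-subst (exts σ) (exts τ) t) (subst-cong (subst-exts σ τ) t))
subst-subst σ τ (app t u) = cong₂ app (subst-subst σ τ t) (subst-subst σ τ u)
subst-subst σ τ (es t u)  =
  cong₂ es (trans (subst-subst (exts σ) (exts τ) t) (subst-cong (subst-exts σ τ) t))
           (subst-subst σ τ u)

exts-var : {n m : ℕ} (ρ : Fin n → Fin m) → exts (var ∘ ρ) ≗ var ∘ ext ρ
exts-var ρ zero    = refl
exts-var ρ (suc x) = refl

rename-as-subst : {n m : ℕ} (ρ : Fin n → Fin m) → rename ρ ≗ subst (var ∘ ρ)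
rename-as-subst ρ (var x)   = refl
rename-as-subst ρ (lam t)   =
  cong lam (trans (rename-as-subst (ext ρ) t) (sym (subst-cong (exts-var ρ) t)))
rename-as-subst ρ (app t u) = cong₂ app (rename-as-subst ρ t) (rename-as-subst ρ u)
rename-as-subst ρ (es t u)  =
  cong₂ es (trans (rename-as-subst (ext ρ) t) (sym (subst-cong (exts-var ρ) t)))
           (rename-as-subst ρ u)

subst-rename-square : {n m n' m' : ℕ}
  (τ : Fin m → Term m') (ρ : Fin n → Fin m) (σ : Fin n → Term n') (ρ' : Fin n' → Fin m') →
  (∀ x → τ (ρ x) ≡ rename ρ' (σ x)) → subst τ ∘ rename ρ ≗ rename ρ' ∘ subst σ
subst-rename-square τ ρ σ ρ' square u = begin
  subst τ (rename ρ u)     ≡⟨ subst-rename τ ρ u ⟩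
  subst (τ ∘ ρ) u          ≡⟨ subst-cong square u ⟩
  subst (rename ρ' ∘ σ) u  ≡⟨ rename-subst ρ' σ u ⟨
  rename ρ' (subst σ u)    ∎
  where open ≡-Reasoning

rename-suc-⟦⟧ : {n m : ℕ} (ρ : Fin n → Fin m) (w : Term m) (t : Term n) →
                rename (ext ρ) (rename suc t) ⟦ w ⟧ ≡ rename ρ t
rename-suc-⟦⟧ ρ w t = begin
  subst (σ₀ w) (rename (ext ρ) (rename suc t))  ≡⟨ cong (subst (σ₀ w)) (rename-rename (ext ρ) suc t) ⟩
  subst (σ₀ w) (rename (suc ∘ ρ) t)             ≡⟨ subst-rename (σ₀ w) (suc ∘ ρ) t ⟩
  subst (var ∘ ρ) t                             ≡⟨ rename-as-subst ρ t ⟨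
  rename ρ t                                    ∎
  where open ≡-Reasoning

subst-renamed-⟦⟧ : {n m n' m' : ℕ}
  (τ : Fin m → Term m') (ρ : Fin n → Fin m) (σ : Fin n → Term n') (ρ' : Fin n' → Fin m') →
  (∀ x → τ (ρ x) ≡ rename ρ' (σ x)) → (t : Term (suc n)) (v : Term m) →
  subst τ (rename (ext ρ) t ⟦ v ⟧) ≡ rename (ext ρ') (subst (exts σ) t) ⟦ subst τ v ⟧
subst-renamed-⟦⟧ τ ρ σ ρ' square t v = begin
  subst τ (subst (σ₀ v) (rename (ext ρ) t))          ≡⟨ subst-subst τ (σ₀ v) (rename (ext ρ) t) ⟩
  subst (subst τ ∘ σ₀ v) (rename (ext ρ) t)          ≡⟨ subst-rename _ (ext ρ) t ⟩
  subst (subst τ ∘ σ₀ v ∘ ext ρ) t                   ≡⟨ subst-cong pointwise t ⟩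
  subst (subst (σ₀ v') ∘ rename (ext ρ') ∘ exts σ) t ≡⟨ subst-subst (σ₀ v') _ t ⟨
  subst (σ₀ v') (subst (rename (ext ρ') ∘ exts σ) t) ≡⟨ cong (subst (σ₀ v')) (rename-subst (ext ρ') (exts σ) t) ⟨
  subst (σ₀ v') (rename (ext ρ') (subst (exts σ) t)) ∎
  where
  open ≡-Reasoning
  v' = subst τ v
  pointwise : subst τ ∘ σ₀ v ∘ ext ρ ≗ subst (σ₀ v') ∘ rename (ext ρ') ∘ exts σ
  pointwise zero    = refl
  pointwise (suc x) = trans (square x) (sym (rename-suc-⟦⟧ ρ' v' (σ x)))

-- Value substitutions and part (1)

ValueSubst : {n m : ℕ} → (Fin n → Term m) → Set
ValueSubst σ = ∀ x → Value (σ x)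

VarSubst : {n m : ℕ} → (Fin n → Term m) → Set
VarSubst {m = m} σ = ∀ x → Σ (Fin m) λ y → σ x ≡ var y

Value-rename : {n m : ℕ} (ρ : Fin n → Fin m) {v : Term n} → Value v → Value (rename ρ v)
Value-rename ρ (vvar x) = vvar (ρ x)
Value-rename ρ (vlam t) = vlam _

Value-subst : {n m : ℕ} {σ : Fin n → Term m} → ValueSubst σ → {v : Term n} → Value v → Value (subst σ v)
Value-subst vσ (vvar x) = vσ x
Value-subst vσ (vlam t) = vlam _

ValueSubst-exts : {n m : ℕ} {σ : Fin n → Term m} → ValueSubst σ → ValueSubst (exts σ)
ValueSubst-exts vσ zero    = vvar zero
ValueSubst-exts vσ (suc x) = Value-rename suc (vσ x)

ValueSubst-σ₀ : {n : ℕ} {v : Term n} → Value v → ValueSubst (σ₀ v)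
ValueSubst-σ₀ vv zero    = vv
ValueSubst-σ₀ vv (suc x) = vvar x

VarSubst-exts : {n m : ℕ} {σ : Fin n → Term m} → VarSubst σ → VarSubst (exts σ)
VarSubst-exts rσ zero = zero , refl
VarSubst-exts rσ (suc x) with rσ x
... | y , σx≡y = suc y , cong (rename suc) σx≡y

VarSubst⇒ValueSubst : {n m : ℕ} {σ : Fin n → Term m} → VarSubst σ → ValueSubst σ
VarSubst⇒ValueSubst {σ = σ} rσ x with σ x | rσ x
... | .(var y) | y , refl = vvar y

VarSubst-renaming : {n m : ℕ} (ρ : Fin n → Fin m) → VarSubst (var ∘ ρ)
VarSubst-renaming ρ x = ρ x , refl

ctxScope : {n m : ℕ} → ℕ → SCtx n m → ℕ
ctxScope n' hole        = n'
ctxScope n' (L ⟨[← u ]) = ctxScope (suc n') L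

substCtx : {n n' m : ℕ} (σ : Fin n → Term n') (L : SCtx n m) → SCtx n' (ctxScope n' L)
substCtx σ hole        = hole
substCtx σ (L ⟨[← u ]) = substCtx (exts σ) L ⟨[← subst σ u ]

substUnder : {n n' m : ℕ} (σ : Fin n → Term n') (L : SCtx n m) → Fin m → Term (ctxScope n' L)
substUnder σ hole        = σ
substUnder σ (L ⟨[← u ]) = substUnder (exts σ) L

plug-subst : {n n' m : ℕ} (σ : Fin n → Term n') (L : SCtx n m) (t : Term m) →
             subst σ (plug L t) ≡ plug (substCtx σ L) (subst (substUnder σ L) t)
plug-subst σ hole        t = refl
plug-subst σ (L ⟨[← u ]) t = cong (λ s → es s (subst σ u)) (plug-subst (exts σ) L t)

ValueSubst-substUnder : {n n' m : ℕ} {σ : Fin n → Term n'} (L : SCtx n m) →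
                        ValueSubst σ → ValueSubst (substUnder σ L)
ValueSubst-substUnder hole        vσ = vσ
ValueSubst-substUnder (L ⟨[← u ]) vσ = ValueSubst-substUnder L (ValueSubst-exts vσ)

VarSubst-substUnder : {n n' m : ℕ} {σ : Fin n → Term n'} (L : SCtx n m) →
                      VarSubst σ → VarSubst (substUnder σ L)
VarSubst-substUnder hole        rσ = rσ
VarSubst-substUnder (L ⟨[← u ]) rσ = VarSubst-substUnder L (VarSubst-exts rσ)

substUnder-wkρ : {n n' m : ℕ} (σ : Fin n → Term n') (L : SCtx n m) (x : Fin n) →
                 substUnder σ L (wkρ L x) ≡ wk (substCtx σ L) (σ x)
substUnder-wkρ σ hole        x = sym (rename-id (σ x))
substUnder-wkρ σ (L ⟨[← u ]) x =
  trans (substUnder-wkρ (exts σ) L (suc x)) (rename-rename (wkρ (substCtx (exts σ) L)) suc (σ x))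

subst-wk : {n n' m : ℕ} (σ : Fin n → Term n') (L : SCtx n m) (u : Term n) →
           subst (substUnder σ L) (wk L u) ≡ wk (substCtx σ L) (subst σ u)
subst-wk σ L = subst-rename-square (substUnder σ L) (wkρ L) σ (wkρ (substCtx σ L)) (substUnder-wkρ σ L)

subst-contractum : {n n' m : ℕ} (σ : Fin n → Term n') (L : SCtx n m) (t : Term (suc n)) (v : Term m) →
  subst (substUnder σ L) (rename (ext (wkρ L)) t ⟦ v ⟧)
    ≡ rename (ext (wkρ (substCtx σ L))) (subst (exts σ) t) ⟦ subst (substUnder σ L) v ⟧
subst-contractum σ L =
  subst-renamed-⟦⟧ (substUnder σ L) (wkρ L) σ (wkρ (substCtx σ L)) (substUnder-wkρ σ L)

⟶-resp-≡ : {n : ℕ} {a a' b b' : Term n} → a ≡ a' → b ≡ b' → a ⟶ b → a' ⟶ b'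
⟶-resp-≡ refl refl s = s

subst-⟶ : {n n' : ℕ} {σ : Fin n → Term n'} → ValueSubst σ →
          {t t' : Term n} → t ⟶ t' → subst σ t ⟶ subst σ t'
subst-⟶ {σ = σ} vσ (rule-m L t u) =
  ⟶-resp-≡ (cong (λ s → app s (subst σ u)) (sym (plug-subst σ L (lam t))))
    (begin
      plug L' (es t' (wk L' (subst σ u)))      ≡⟨ cong (plug L' ∘ es t') (subst-wk σ L u) ⟨
      plug L' (subst σ' (es t (wk L u)))       ≡⟨ plug-subst σ L (es t (wk L u)) ⟨
      subst σ (plug L (es t (wk L u)))         ∎)
    (rule-m L' t' (subst σ u))
  where
  open ≡-Reasoning
  L' = substCtx σ L
  σ' = substUnder σ L
  t' = subst (exts σ') t
subst-⟶ {σ = σ} vσ (rule-e t L v vv) =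
  ⟶-resp-≡ (cong (es (subst (exts σ) t)) (sym (plug-subst σ L v)))
    (begin
      plug L' (rename (ext (wkρ L')) (subst (exts σ) t) ⟦ subst σ' v ⟧) ≡⟨ cong (plug L') (subst-contractum σ L t v) ⟨
      plug L' (subst σ' (rename (ext (wkρ L)) t ⟦ v ⟧))                   ≡⟨ plug-subst σ L _ ⟨
      subst σ (plug L (rename (ext (wkρ L)) t ⟦ v ⟧))                     ∎)
    (rule-e (subst (exts σ) t) L' (subst σ' v) (Value-subst (ValueSubst-substUnder L vσ) vv))
  where
  open ≡-Reasoning
  L' = substCtx σ L
  σ' = substUnder σ L
subst-⟶ vσ (ctx-appR s) = ctx-appR (subst-⟶ vσ s)
subst-⟶ vσ (ctx-appL s) = ctx-appL (subst-⟶ vσ s)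
subst-⟶ vσ (ctx-esL s)  = ctx-esL (subst-⟶ (ValueSubst-exts vσ) s)
subst-⟶ vσ (ctx-esR s)  = ctx-esR (subst-⟶ vσ s)

-- Big-step evaluation under renamings; fireballs as normal forms

⇓-resp-≡ : {n k : ℕ} {a a' b b' : Term n} → a ≡ a' → b ≡ b' → a ⇓[ k ] b → a' ⇓[ k ] b'
⇓-resp-≡ refl refl d = d

⇓-resp-cost : {n k k' : ℕ} {a b : Term n} → k ≡ k' → a ⇓[ k ] b → a ⇓[ k' ] b
⇓-resp-cost refl d = d

InertApp-subst : {n m : ℕ} {σ : Fin n → Term m} → VarSubst σ → {a : Term n} → InertApp a → InertApp (subst σ a)
Inert-subst    : {n m : ℕ} {σ : Fin n → Term m} → VarSubst σ → {a : Term n} → Inert a → Inert (subst σ a)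
Fireball-subst : {n m : ℕ} {σ : Fin n → Term m} → VarSubst σ → {a : Term n} → Fireball a → Fireball (subst σ a)

InertApp-subst {σ = σ} rσ (ia-var x f) with σ x | rσ x
... | .(var y) | y , refl = ia-var y (Fireball-subst rσ f)
InertApp-subst rσ (ia-app a f) = ia-app (InertApp-subst rσ a) (Fireball-subst rσ f)
Inert-subst rσ (in-app a)   = in-app (InertApp-subst rσ a)
Inert-subst rσ (in-es i i') = in-es (Inert-subst (VarSubst-exts rσ) i) (Inert-subst rσ i')
Fireball-subst rσ (fb-val v)   = fb-val (Value-subst (VarSubst⇒ValueSubst rσ) v)
Fireball-subst rσ (fb-inert i) = fb-inert (Inert-subst rσ i)
Fireball-subst rσ (fb-es f i)  = fb-es (Fireball-subst (VarSubst-exts rσ) f) (Inert-subst rσ i)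

Fireball-rename : {n m : ℕ} (ρ : Fin n → Fin m) {a : Term n} → Fireball a → Fireball (rename ρ a)
Fireball-rename ρ {a} f = ≡-subst Fireball (sym (rename-as-subst ρ a)) (Fireball-subst (VarSubst-renaming ρ) f)

InertCtx-subst : {n n' m : ℕ} {σ : Fin n → Term n'} → VarSubst σ →
                 {I : SCtx n m} → InertCtx I → InertCtx (substCtx σ I)
InertCtx-subst rσ ic-hole     = ic-hole
InertCtx-subst rσ (ic-es I i) = ic-es (InertCtx-subst (VarSubst-exts rσ) I) (Inert-subst rσ i)

⇓-subst : {n m k : ℕ} {σ : Fin n → Term m} → VarSubst σ → {t f : Term n} →
          t ⇓[ k ] f → subst σ t ⇓[ k ] subst σ f
⇓-subst rσ (bs-val v) = bs-val (Value-subst (VarSubst⇒ValueSubst rσ) v)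
⇓-subst {σ = σ} rσ (bs-β {u = u} {I = I} {s = s} {f = f} ic D₁ D₂) =
  ⇓-resp-≡ refl (sym (plug-subst σ I f))
    (bs-β (InertCtx-subst rσ ic) (⇓-resp-≡ refl (plug-subst σ I (lam s)) (⇓-subst rσ D₁))
      (⇓-resp-≡ (cong (es _) (subst-wk σ I u)) refl (⇓-subst (VarSubst-substUnder I rσ) D₂)))
⇓-subst {σ = σ} rσ (bs-var {u = u} {f = f} {I = I} {x = x} ic D₁ D₂)
  with substUnder σ I x | VarSubst-substUnder I rσ x | plug-subst σ I (var x)
     | plug-subst σ I (app (var x) (wk I f))
... | .(var y) | y , refl | plug-x | plug-xf =
  ⇓-resp-≡ refl (sym (trans plug-xf (cong (plug _ ∘ app (var y)) (subst-wk σ I f))))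
    (bs-var (InertCtx-subst rσ ic) (⇓-resp-≡ refl plug-x (⇓-subst rσ D₁)) (⇓-subst rσ D₂))
⇓-subst {σ = σ} rσ (bs-ia {f = f} {I = I} {a = a} ic ia D₁ D₂) =
  ⇓-resp-≡ refl (sym (trans (plug-subst σ I _) (cong (plug _ ∘ app _) (subst-wk σ I f))))
    (bs-ia (InertCtx-subst rσ ic) (InertApp-subst (VarSubst-substUnder I rσ) ia)
      (⇓-resp-≡ refl (plug-subst σ I a) (⇓-subst rσ D₁)) (⇓-subst rσ D₂))
⇓-subst {σ = σ} rσ (bs-es {t = t} {I = I} {v = v} {f = f} ic vv D₁ D₂) =
  ⇓-resp-≡ refl (sym (plug-subst σ I f))
    (bs-es (InertCtx-subst rσ ic) (Value-subst (VarSubst⇒ValueSubst (VarSubst-substUnder I rσ)) vv)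
      (⇓-resp-≡ refl (plug-subst σ I v) (⇓-subst rσ D₁))
      (⇓-resp-≡ (subst-contractum σ I t v) refl (⇓-subst (VarSubst-substUnder I rσ) D₂)))
⇓-subst rσ (bs-esi D₁ D₂ i) = bs-esi (⇓-subst (VarSubst-exts rσ) D₁) (⇓-subst rσ D₂) (Inert-subst rσ i)

⇓-rename : {n m k : ℕ} (ρ : Fin n → Fin m) {t f : Term n} → t ⇓[ k ] f → rename ρ t ⇓[ k ] rename ρ f
⇓-rename ρ {t} {f} D =
  ⇓-resp-≡ (sym (rename-as-subst ρ t)) (sym (rename-as-subst ρ f)) (⇓-subst (VarSubst-renaming ρ) D)

Fireball-⇓-refl : {n : ℕ} {f : Term n} → Fireball f → f ⇓[ 0 ] f
Inert-⇓-refl    : {n : ℕ} {f : Term n} → Inert f → f ⇓[ 0 ] f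
InertApp-⇓-refl : {n : ℕ} {f : Term n} → InertApp f → f ⇓[ 0 ] f
Fireball-⇓-refl (fb-val v)   = bs-val v
Fireball-⇓-refl (fb-inert i) = Inert-⇓-refl i
Fireball-⇓-refl (fb-es f i)  = bs-esi (Fireball-⇓-refl f) (Inert-⇓-refl i) i
Inert-⇓-refl (in-app a)   = InertApp-⇓-refl a
Inert-⇓-refl (in-es i i') = bs-esi (Inert-⇓-refl i) (Inert-⇓-refl i') i'
InertApp-⇓-refl (ia-var x {f} fb) =
  ⇓-resp-≡ refl (cong (app (var x)) (rename-id f))
    (bs-var {I = hole} ic-hole (bs-val (vvar x)) (Fireball-⇓-refl fb))
InertApp-⇓-refl (ia-app {f = f} a fb) =
  ⇓-resp-≡ refl (cong (app _) (rename-id f))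
    (bs-ia {I = hole} ic-hole a (InertApp-⇓-refl a) (Fireball-⇓-refl fb))

Fireball-plug : {n m : ℕ} {I : SCtx n m} {f : Term m} → InertCtx I → Fireball f → Fireball (plug I f)
Fireball-plug ic-hole     f = f
Fireball-plug (ic-es I i) f = fb-es (Fireball-plug I f) i

⇓-Fireball : {n k : ℕ} {t f : Term n} → t ⇓[ k ] f → Fireball f
⇓-Fireball (bs-val v)           = fb-val v
⇓-Fireball (bs-β ic D₁ D₂)      = Fireball-plug ic (⇓-Fireball D₂)
⇓-Fireball (bs-var {I = I} {x = x} ic D₁ D₂) =
  Fireball-plug ic (fb-inert (in-app (ia-var x (Fireball-rename (wkρ I) (⇓-Fireball D₂)))))
⇓-Fireball (bs-ia {I = I} ic a D₁ D₂) =
  Fireball-plug ic (fb-inert (in-app (ia-app a (Fireball-rename (wkρ I) (⇓-Fireball D₂)))))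
⇓-Fireball (bs-es ic v D₁ D₂)   = Fireball-plug ic (⇓-Fireball D₂)
⇓-Fireball (bs-esi D₁ D₂ i)     = fb-es (⇓-Fireball D₁) i

¬InertApp-plug-lam : {n m : ℕ} (I : SCtx n m) {s : Term (suc m)} → InertApp (plug I (lam s)) → ⊥
¬InertApp-plug-lam hole        ()
¬InertApp-plug-lam (I ⟨[← u ]) ()

¬InertApp-plug-var : {n m : ℕ} (I : SCtx n m) {x : Fin m} → InertApp (plug I (var x)) → ⊥
¬InertApp-plug-var hole        ()
¬InertApp-plug-var (I ⟨[← u ]) ()

¬Inert-plug-Value : {n m : ℕ} (I : SCtx n m) {v : Term m} → Value v → Inert (plug I v) → ⊥
¬Inert-plug-Value hole        (vvar x) (in-app ())
¬Inert-plug-Value hole        (vlam t) (in-app ())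
¬Inert-plug-Value (I ⟨[← u ]) vv       (in-es i i') = ¬Inert-plug-Value I vv i

Value-⇓-inv : {n c : ℕ} {v R : Term n} → Value v → v ⇓[ c ] R → c ≡ 0 × R ≡ v
Value-⇓-inv (vvar x) (bs-val _) = refl , refl
Value-⇓-inv (vlam t) (bs-val _) = refl , refl

InertApp-⇓-inv : {n c : ℕ} {a R : Term n} → InertApp a → a ⇓[ c ] R → c ≡ 0 × R ≡ a
Inert-⇓-inv    : {n c : ℕ} {a R : Term n} → Inert a → a ⇓[ c ] R → c ≡ 0 × R ≡ a
Fireball-⇓-inv : {n c : ℕ} {a R : Term n} → Fireball a → a ⇓[ c ] R → c ≡ 0 × R ≡ a

InertApp-⇓-inv (ia-var x f) (bs-β {I = hole} ic D₁ D₂) with Value-⇓-inv (vvar x) D₁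
... | _ , ()
InertApp-⇓-inv (ia-var x f) (bs-β {I = _ ⟨[← _ ]} ic D₁ D₂) with Value-⇓-inv (vvar x) D₁
... | _ , ()
InertApp-⇓-inv (ia-var x f) (bs-var {I = hole} ic D₁ D₂) with Value-⇓-inv (vvar x) D₁ | Fireball-⇓-inv f D₂
... | refl , refl | refl , refl = refl , cong (app (var x)) (rename-id _)
InertApp-⇓-inv (ia-var x f) (bs-var {I = _ ⟨[← _ ]} ic D₁ D₂) with Value-⇓-inv (vvar x) D₁
... | _ , ()
InertApp-⇓-inv (ia-var x f) (bs-ia {I = hole} ic a D₁ D₂) with Value-⇓-inv (vvar x) D₁
InertApp-⇓-inv (ia-var x f) (bs-ia {I = hole} ic () D₁ D₂) | _ , refl
InertApp-⇓-inv (ia-var x f) (bs-ia {I = _ ⟨[← _ ]} ic a D₁ D₂) with Value-⇓-inv (vvar x) D₁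
... | _ , ()
InertApp-⇓-inv (ia-app a f) (bs-β {I = I} ic D₁ D₂) with InertApp-⇓-inv a D₁
... | refl , refl = ⊥-elim (¬InertApp-plug-lam I a)
InertApp-⇓-inv (ia-app a f) (bs-var {I = I} ic D₁ D₂) with InertApp-⇓-inv a D₁
... | refl , refl = ⊥-elim (¬InertApp-plug-var I a)
InertApp-⇓-inv (ia-app a f) (bs-ia {I = hole} ic a' D₁ D₂) with InertApp-⇓-inv a D₁ | Fireball-⇓-inv f D₂
... | refl , refl | refl , refl = refl , cong (app _) (rename-id _)
InertApp-⇓-inv (ia-app a f) (bs-ia {I = _ ⟨[← _ ]} ic a' D₁ D₂) with InertApp-⇓-inv a D₁
... | refl , refl with a
... | ()
Inert-⇓-inv (in-app a) D = InertApp-⇓-inv a D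
Inert-⇓-inv (in-es i i') (bs-es {I = I} ic vv D₁ D₂) with Inert-⇓-inv i' D₁
... | refl , refl = ⊥-elim (¬Inert-plug-Value I vv i')
Inert-⇓-inv (in-es i i') (bs-esi D₁ D₂ _) with Inert-⇓-inv i D₁ | Inert-⇓-inv i' D₂
... | refl , refl | refl , refl = refl , refl
Fireball-⇓-inv (fb-val v)   D = Value-⇓-inv v D
Fireball-⇓-inv (fb-inert i) D = Inert-⇓-inv i D
Fireball-⇓-inv (fb-es f i) (bs-es {I = I} ic vv D₁ D₂) with Inert-⇓-inv i D₁
... | refl , refl = ⊥-elim (¬Inert-plug-Value I vv i)
Fireball-⇓-inv (fb-es f i) (bs-esi D₁ D₂ _) with Fireball-⇓-inv f D₁ | Inert-⇓-inv i D₂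
... | refl , refl | refl , refl = refl , refl

-- Substitution contexts around heads, values and bodies

infixr 5 _++_
_++_ : {n m₁ m : ℕ} → SCtx n m₁ → SCtx m₁ m → SCtx n m
hole        ++ J = J
(L ⟨[← u ]) ++ J = (L ++ J) ⟨[← u ]

++-identityʳ : {n m : ℕ} (L : SCtx n m) → L ++ hole ≡ L
++-identityʳ hole        = refl
++-identityʳ (L ⟨[← u ]) = cong (_⟨[← u ]) (++-identityʳ L)

plug-++ : {n m₁ m : ℕ} (L : SCtx n m₁) (J : SCtx m₁ m) (t : Term m) → plug (L ++ J) t ≡ plug L (plug J t)
plug-++ hole        J t = refl
plug-++ (L ⟨[← u ]) J t = cong (λ s → es s u) (plug-++ L J t)

wkρ-++ : {n m₁ m : ℕ} (L : SCtx n m₁) (J : SCtx m₁ m) → wkρ (L ++ J) ≗ wkρ J ∘ wkρ L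
wkρ-++ hole        J x = refl
wkρ-++ (L ⟨[← u ]) J x = wkρ-++ L J (suc x)

wk-++ : {n m₁ m : ℕ} (L : SCtx n m₁) (J : SCtx m₁ m) (u : Term n) → wk (L ++ J) u ≡ wk J (wk L u)
wk-++ L J u = trans (rename-cong (wkρ-++ L J) u) (sym (rename-rename (wkρ J) (wkρ L) u))

InertCtx-++ʳ : {n m₁ m : ℕ} (L : SCtx n m₁) {J : SCtx m₁ m} → InertCtx (L ++ J) → InertCtx J
InertCtx-++ʳ hole        ic          = ic
InertCtx-++ʳ (L ⟨[← u ]) (ic-es ic i) = InertCtx-++ʳ L ic

data NotES {n : ℕ} : Term n → Set where
  var : (x : Fin n) → NotES (var x)
  lam : (t : Term (suc n)) → NotES (lam t)
  app : (t u : Term n) → NotES (app t u)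

Value⇒NotES : {n : ℕ} {a : Term n} → Value a → NotES a
Value⇒NotES (vvar x) = var x
Value⇒NotES (vlam t) = lam t

InertApp⇒NotES : {n : ℕ} {a : Term n} → InertApp a → NotES a
InertApp⇒NotES (ia-var x f) = app _ _
InertApp⇒NotES (ia-app a f) = app _ _

es-injective : {n : ℕ} {a a' : Term (suc n)} {b b' : Term n} → es a b ≡ es a' b' → a ≡ a' × b ≡ b'
es-injective refl = refl , refl

plug-split : {n m' m : ℕ} (I' : SCtx n m') (I : SCtx n m) {R : Term m'} {h : Term m} → NotES h →
             plug I' R ≡ plug I h → Σ (SCtx m' m) λ I₀ → I ≡ I' ++ I₀ × R ≡ plug I₀ h
plug-split hole I h e = I , refl , e
plug-split (I' ⟨[← u ]) hole (var x)   ()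
plug-split (I' ⟨[← u ]) hole (lam t)   ()
plug-split (I' ⟨[← u ]) hole (app t s) ()
plug-split (I' ⟨[← u ]) (I ⟨[← u' ]) h e with es-injective e
... | e₁ , refl with plug-split I' I h e₁
... | I₀ , refl , R≡ = I₀ , refl , R≡

data SamePlug {n m' : ℕ} (I' : SCtx n m') (R : Term m') : {m : ℕ} → SCtx n m → Term m → Set where
  same : SamePlug I' R I' R

plug-Value-injective : {n m' m : ℕ} (I' : SCtx n m') (I : SCtx n m) {R : Term m'} {h : Term m} →
                       Value R → NotES h → plug I' R ≡ plug I h → SamePlug I' R I h
plug-Value-injective I' I vR nh e with plug-split I' I nh e
... | hole , refl , refl rewrite ++-identityʳ I' = same
plug-Value-injective I' I () nh e | (_ ⟨[← _ ]) , _ , refl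

data Head {n : ℕ} : Term n → Set where
  head-lam   : (s : Term (suc n)) → Head (lam s)
  head-var   : (x : Fin n) → Head (var x)
  head-inert : {a : Term n} → InertApp a → Head a

data HeadDecomposition {n : ℕ} : Term n → Set where
  decomposition : {m : ℕ} (J : SCtx n m) {h : Term m} → InertCtx J → Head h → HeadDecomposition (plug J h)

Inert-decompose : {n : ℕ} {f : Term n} → Inert f → HeadDecomposition f
Inert-decompose (in-app a) = decomposition hole ic-hole (head-inert a)
Inert-decompose (in-es i i') with Inert-decompose i
... | decomposition J ic h = decomposition (J ⟨[← _ ]) (ic-es ic i') h

Fireball-decompose : {n : ℕ} {f : Term n} → Fireball f → HeadDecomposition f
Fireball-decompose (fb-val (vvar x)) = decomposition hole ic-hole (head-var x)
Fireball-decompose (fb-val (vlam t)) = decomposition hole ic-hole (head-lam t)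
Fireball-decompose (fb-inert i)      = Inert-decompose i
Fireball-decompose (fb-es f i) with Fireball-decompose f
... | decomposition J ic h = decomposition (J ⟨[← _ ]) (ic-es ic i) h

data InertOrValue {n : ℕ} : Term n → Set where
  inert : {f : Term n} → Inert f → InertOrValue f
  value : {m : ℕ} (J : SCtx n m) {v : Term m} → InertCtx J → Value v → InertOrValue (plug J v)

Fireball-inertOrValue : {n : ℕ} {f : Term n} → Fireball f → InertOrValue f
Fireball-inertOrValue (fb-val v)   = value hole ic-hole v
Fireball-inertOrValue (fb-inert i) = inert i
Fireball-inertOrValue (fb-es f i) with Fireball-inertOrValue f
... | inert f'        = inert (in-es f' i)
... | value J ic vv   = value (J ⟨[← _ ]) (ic-es ic i) vv

-- The substitution under which the body t of  t[x←u]  continues once  σ u ⇓ I⟨w⟩  (rule bs-es).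
fireSubst : {n n' m : ℕ} (σ : Fin n → Term n') (I : SCtx n' m) (w : Term m) → Fin (suc n) → Term m
fireSubst σ I w x = rename (ext (wkρ I)) (exts σ x) ⟦ w ⟧

ValueSubst-fireSubst : {n n' m : ℕ} {σ : Fin n → Term n'} → ValueSubst σ →
                       (I : SCtx n' m) {w : Term m} → Value w → ValueSubst (fireSubst σ I w)
ValueSubst-fireSubst vσ I vw x =
  Value-subst (ValueSubst-σ₀ vw) (Value-rename (ext (wkρ I)) (ValueSubst-exts vσ x))

subst-fireSubst : {n n' m : ℕ} (σ : Fin n → Term n') (I : SCtx n' m) (w : Term m) (t : Term (suc n)) →
                  subst (fireSubst σ I w) t ≡ rename (ext (wkρ I)) (subst (exts σ) t) ⟦ w ⟧
subst-fireSubst σ I w t = begin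
  subst (subst (σ₀ w) ∘ rename (ext (wkρ I)) ∘ exts σ) t  ≡⟨ subst-subst (σ₀ w) _ t ⟨
  subst (σ₀ w) (subst (rename (ext (wkρ I)) ∘ exts σ) t) ≡⟨ cong (subst (σ₀ w)) (rename-subst (ext (wkρ I)) (exts σ) t) ⟨
  subst (σ₀ w) (rename (ext (wkρ I)) (subst (exts σ) t)) ∎
  where open ≡-Reasoning

-- Evaluating σ(J⟨B⟩) first evaluates the substitutions of J: the inert ones are collected in I,
-- the ones producing values extend σ to τ.  The body B then runs under τ, and the same prefix
-- of the evaluation can be replayed around any other body.
record CtxEvaluation {n n' m : ℕ} (J : SCtx n m) (B : Term m) (σ : Fin n → Term n')
                     (c : ℕ) (R : Term n') : Set where
  constructor ctx-evaluation
  field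
    {m'}    : ℕ
    I       : SCtx n' m'
    τ       : Fin m → Term m'
    τ-value : ValueSubst τ
    c₁ c₂   : ℕ
    R₀      : Term m'
    cost    : c ≡ c₁ + c₂
    result  : R ≡ plug I R₀
    body-⇓  : subst τ B ⇓[ c₂ ] R₀
    τ-wk    : ∀ x → τ (wkρ J x) ≡ wk I (σ x)
    replay  : ∀ {Y Z j} → subst τ Y ⇓[ j ] Z → subst σ (plug J Y) ⇓[ c₁ + j ] plug I Z

⇓-through-ctx : {n n' m : ℕ} (J : SCtx n m) (B : Term m) {σ : Fin n → Term n'} → ValueSubst σ →
                {c : ℕ} {R : Term n'} → subst σ (plug J B) ⇓[ c ] R → CtxEvaluation J B σ c R
⇓-through-ctx hole B vσ D =
  ctx-evaluation hole _ vσ 0 _ _ refl refl D (λ x → sym (rename-id _)) id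
⇓-through-ctx (J ⟨[← _ ]) B {σ} vσ (bs-esi {h = h} {i = i} D₁ D₂ ii)
  with ⇓-through-ctx J B (ValueSubst-exts vσ) D₁
... | ctx-evaluation I τ vτ c₁ c₂ R₀ refl R≡ B⇓ τ-wk replay =
  ctx-evaluation (I ⟨[← i ]) τ vτ (c₁ + h) c₂ R₀ (swap c₁ c₂ h) (cong (λ s → es s i) R≡) B⇓
    (λ x → trans (τ-wk (suc x)) (rename-rename (wkρ I) suc (σ x)))
    (λ {_} {_} {j} d → ⇓-resp-cost (swap c₁ j h) (bs-esi (replay d) D₂ ii))
  where
  swap : ∀ a b c → a + b + c ≡ a + c + b
  swap = solve-∀
⇓-through-ctx (J ⟨[← _ ]) B {σ} vσ (bs-es {k = k} {I = I₁} {v = w} ic vw D₁ D₂)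
  with ⇓-through-ctx J B (ValueSubst-fireSubst vσ I₁ vw)
         (⇓-resp-≡ (sym (subst-fireSubst σ I₁ w (plug J B))) refl D₂)
... | ctx-evaluation I τ vτ c₁ c₂ R₀ refl R≡ B⇓ τ-wk replay =
  ctx-evaluation (I₁ ++ I) τ vτ (k + c₁ + 1) c₂ R₀ (shift k c₁ c₂)
    (trans (cong (plug I₁) R≡) (sym (plug-++ I₁ I R₀))) B⇓ τ-wk'
    (λ {_} {Z} {j} d → ⇓-resp-cost (shift k c₁ j) (⇓-resp-≡ refl (sym (plug-++ I₁ I Z))
       (bs-es ic vw D₁ (⇓-resp-≡ (subst-fireSubst σ I₁ w (plug J _)) refl (replay d)))))
  where
  shift : ∀ a b c → a + (b + c) + 1 ≡ a + b + 1 + c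
  shift = solve-∀
  τ-wk' : ∀ x → τ (wkρ J (suc x)) ≡ wk (I₁ ++ I) (σ x)
  τ-wk' x = begin
    τ (wkρ J (suc x))                        ≡⟨ τ-wk (suc x) ⟩
    wk I (rename (ext (wkρ I₁)) (rename suc (σ x)) ⟦ w ⟧) ≡⟨ cong (wk I) (rename-suc-⟦⟧ (wkρ I₁) w (σ x)) ⟩
    wk I (wk I₁ (σ x))                       ≡⟨ wk-++ I₁ I (σ x) ⟨
    wk (I₁ ++ I) (σ x)                       ∎
    where open ≡-Reasoning

subst-τ-wk : {n n' m c : ℕ} {J : SCtx n m} {B : Term m} {σ : Fin n → Term n'} {R : Term n'}
             (ce : CtxEvaluation J B σ c R) (u : Term n) →
             subst (CtxEvaluation.τ ce) (wk J u) ≡ wk (CtxEvaluation.I ce) (subst σ u)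
subst-τ-wk {J = J} {σ = σ} ce = subst-rename-square τ (wkρ J) σ (wkρ I) τ-wk
  where open CtxEvaluation ce

-- Factorisation of evaluation under a value substitution

m+n+1≤o⇒n<o : ∀ m {n o} → m + n + 1 ≤ o → n < o
m+n+1≤o⇒n<o m {n} {o} le = m+n≤o⇒n≤o m (≡-subst (_≤ o) (trans (+-comm (m + n) 1) (sym (+-suc m n))) le)

m+n+1≤o⇒m≤o : ∀ m {n o} → m + n + 1 ≤ o → m ≤ o
m+n+1≤o⇒m≤o m le = m+n≤o⇒m≤o m (m+n≤o⇒m≤o _ le)

+-interchange : ∀ a b c d → a + b + (c + d) ≡ a + c + (b + d)
+-interchange = solve-∀

≤-by-split : ∀ m {n k o} → k ≡ m + n → k ≤ o → n ≤ o
≤-by-split m refl = m+n≤o⇒n≤o m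

redex-cost : ∀ c₁ b d → c₁ + 0 + (b + d) + 1 ≡ 0 + b + 1 + (c₁ + d)
redex-cost = solve-∀

record Factorisation {n n' : ℕ} (t : Term n) (σ : Fin n → Term n') (k : ℕ) (nf : Term n') : Set where
  constructor factorisation
  field
    k₁ k₂   : ℕ
    nf'     : Term n
    cost    : k ≡ k₁ + k₂
    t-⇓     : t ⇓[ k₁ ] nf'
    σnf'-⇓  : subst σ nf' ⇓[ k₂ ] nf

es-⇓-split : {n i : ℕ} {t : Term (suc n)} {u f : Term n} → es t u ⇓[ i ] f →
             ∃[ c ] ∃[ i' ] ∃[ u' ] (u ⇓[ c ] u' × es t u' ⇓[ i' ] f × i ≡ c + i')
es-⇓-split (bs-es {k = c} {i = j} ic vw D₁ D₂) =
  c , _ , _ , D₁ , bs-es ic vw (Fireball-⇓-refl (Fireball-plug ic (fb-val vw))) D₂ , +-assoc c j 1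
es-⇓-split (bs-esi {k = c} {h = h} D₁ D₂ i) =
  h , _ , _ , D₂ , bs-esi D₁ (Inert-⇓-refl i) i , trans (+-comm c h) (cong (h +_) (sym (+-identityʳ c)))

es-arg-⇓ : {n a c : ℕ} {t : Term (suc n)} {u u' f : Term n} →
           u ⇓[ a ] u' → es t u' ⇓[ c ] f → es t u ⇓[ a + c ] f
es-arg-⇓ {a = a} ev (bs-es {i = j} ic vw D₁ D₂) with Fireball-⇓-inv (⇓-Fireball ev) D₁
... | refl , refl = ⇓-resp-cost (+-assoc a j 1) (bs-es ic vw ev D₂)
es-arg-⇓ {a = a} ev (bs-esi {k = c} D₁ D₂ i) with Fireball-⇓-inv (⇓-Fireball ev) D₂
... | refl , refl = ⇓-resp-cost (trans (+-comm c a) (cong (a +_) (sym (+-identityʳ c)))) (bs-esi D₁ ev i)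

app-args-⇓ : {n a a₂ c : ℕ} {t₁ t₂ n₁ n₂ f : Term n} →
             t₁ ⇓[ a ] n₁ → t₂ ⇓[ a₂ ] n₂ → app n₁ n₂ ⇓[ c ] f → app t₁ t₂ ⇓[ a + a₂ + c ] f
app-args-⇓ {a = a} {a₂} ev₁ ev₂ (bs-β {i = i} {I = I} ic D₁ D₂) with Fireball-⇓-inv (⇓-Fireball ev₁) D₁
... | refl , refl = ⇓-resp-cost (cost a a₂ i) (bs-β ic ev₁ (es-arg-⇓ (⇓-rename (wkρ I) ev₂) D₂))
  where
  cost : ∀ a b c → a + (b + c) + 1 ≡ a + b + (0 + c + 1)
  cost = solve-∀
app-args-⇓ {a = a} {a₂} ev₁ ev₂ (bs-var ic D₁ D₂)
  with Fireball-⇓-inv (⇓-Fireball ev₁) D₁ | Fireball-⇓-inv (⇓-Fireball ev₂) D₂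
... | refl , refl | refl , refl = ⇓-resp-cost (sym (+-identityʳ (a + a₂))) (bs-var ic ev₁ ev₂)
app-args-⇓ {a = a} {a₂} ev₁ ev₂ (bs-ia ic ia D₁ D₂)
  with Fireball-⇓-inv (⇓-Fireball ev₁) D₁ | Fireball-⇓-inv (⇓-Fireball ev₂) D₂
... | refl , refl | refl , refl = ⇓-resp-cost (sym (+-identityʳ (a + a₂))) (bs-ia ic ia ev₁ ev₂)

Factorisation-app : {n n' a a₂ k k' : ℕ} {t₁ t₂ n₁ n₂ : Term n} {σ : Fin n → Term n'} {nf : Term n'} →
                    t₁ ⇓[ a ] n₁ → t₂ ⇓[ a₂ ] n₂ → k ≡ a + a₂ + k' →
                    Factorisation (app n₁ n₂) σ k' nf → Factorisation (app t₁ t₂) σ k nf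
Factorisation-app {a = a} {a₂} ev₁ ev₂ refl (factorisation c d nf' refl ev sev) =
  factorisation (a + a₂ + c) d nf' (sym (+-assoc (a + a₂) c d)) (app-args-⇓ ev₁ ev₂ ev) sev

Factorisation-es : {n n' a k k' : ℕ} {t₁ : Term (suc n)} {t₂ n₂ : Term n} {σ : Fin n → Term n'} {nf : Term n'} →
                   t₂ ⇓[ a ] n₂ → k ≡ a + k' → Factorisation (es t₁ n₂) σ k' nf → Factorisation (es t₁ t₂) σ k nf
Factorisation-es {a = a} ev₂ refl (factorisation c d nf' refl ev sev) =
  factorisation (a + c) d nf' (sym (+-assoc a c d)) (es-arg-⇓ ev₂ ev) sev

factorise-stuck-app : {n n' m : ℕ} (J : SCtx n m) (h₀ : Term m) (n₂ : Term n) {σ : Fin n → Term n'} →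
  ValueSubst σ → app (plug J h₀) n₂ ⇓[ 0 ] plug J (app h₀ (wk J n₂)) →
  ∀ {k nf} → app (subst σ (plug J h₀)) (subst σ n₂) ⇓[ k ] nf → Factorisation (app (plug J h₀) n₂) σ k nf
factorise-stuck-app J h₀ n₂ vσ stuck (bs-β {i = i} {I = I} {s = s} {f = f} ic D₁ D₂)
  with ⇓-through-ctx J h₀ vσ D₁
... | ce@(ctx-evaluation I' _ _ c₁ c₂ _ refl R≡ h₀-⇓ _ replay)
  with plug-split I' I (lam s) (sym R≡)
... | I₀ , refl , refl =
  factorisation 0 _ _ refl stuck
    (⇓-resp-≡ refl (sym (plug-++ I' I₀ f)) (⇓-resp-cost (cost c₁ c₂ i)
      (replay (⇓-resp-≡ (cong (app _) (sym (subst-τ-wk ce n₂))) refl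
        (bs-β (InertCtx-++ʳ I' ic) h₀-⇓ (⇓-resp-≡ (cong (es s) (wk-++ I' I₀ _)) refl D₂))))))
  where
  cost : ∀ a b c → a + (b + c + 1) ≡ a + b + c + 1
  cost = solve-∀
factorise-stuck-app J h₀ n₂ vσ stuck (bs-var {h = h} {f = f} {I = I} {x = x} ic D₁ D₂)
  with ⇓-through-ctx J h₀ vσ D₁
... | ce@(ctx-evaluation I' _ _ c₁ c₂ _ refl R≡ h₀-⇓ _ replay)
  with plug-split I' I (var x) (sym R≡)
... | I₀ , refl , refl =
  factorisation 0 _ _ refl stuck
    (⇓-resp-≡ refl (sym (trans (plug-++ I' I₀ _) (cong (plug I' ∘ plug I₀ ∘ app (var x)) (wk-++ I' I₀ f))))
      (⇓-resp-cost (sym (+-assoc c₁ c₂ h))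
        (replay (⇓-resp-≡ (cong (app _) (sym (subst-τ-wk ce n₂))) refl
          (bs-var (InertCtx-++ʳ I' ic) h₀-⇓ (⇓-rename (wkρ I') D₂))))))
factorise-stuck-app J h₀ n₂ vσ stuck (bs-ia {h = h} {f = f} {I = I} {a = a} ic ia D₁ D₂)
  with ⇓-through-ctx J h₀ vσ D₁
... | ce@(ctx-evaluation I' _ _ c₁ c₂ _ refl R≡ h₀-⇓ _ replay)
  with plug-split I' I (InertApp⇒NotES ia) (sym R≡)
... | I₀ , refl , refl =
  factorisation 0 _ _ refl stuck
    (⇓-resp-≡ refl (sym (trans (plug-++ I' I₀ _) (cong (plug I' ∘ plug I₀ ∘ app a) (wk-++ I' I₀ f))))
      (⇓-resp-cost (sym (+-assoc c₁ c₂ h))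
        (replay (⇓-resp-≡ (cong (app _) (sym (subst-τ-wk ce n₂))) refl
          (bs-ia (InertCtx-++ʳ I' ic) ia h₀-⇓ (⇓-rename (wkρ I') D₂))))))

-- Termination: every call either keeps the cost bound K and goes to a proper subterm of t,
-- or goes down in the accessibility proof of K.
factorise : ∀ {K} → Acc _<_ K → ∀ {n n'} (t : Term n) {σ : Fin n → Term n'} → ValueSubst σ →
            ∀ {k nf} → k ≤ K → subst σ t ⇓[ k ] nf → Factorisation t σ k nf
factorise-redex : ∀ {K} → Acc _<_ K → ∀ {n n'} {n₁ : Term n} → HeadDecomposition n₁ → {n₂ : Term n} → Fireball n₂ →
                  {σ : Fin n → Term n'} → ValueSubst σ →
                  ∀ {k nf} → k ≤ K → app (subst σ n₁) (subst σ n₂) ⇓[ k ] nf → Factorisation (app n₁ n₂) σ k nf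
factorise-es-fireball : ∀ {K} → Acc _<_ K → ∀ {n n'} (t₁ : Term (suc n)) {n₂ : Term n} → InertOrValue n₂ →
                        {σ : Fin n → Term n'} → ValueSubst σ →
                        ∀ {k nf} → k ≤ K → es (subst (exts σ) t₁) (subst σ n₂) ⇓[ k ] nf → Factorisation (es t₁ n₂) σ k nf

factorise _ (var x) _ _ D = factorisation 0 _ (var x) refl (bs-val (vvar x)) D
factorise _ (lam t) _ _ D = factorisation 0 _ (lam t) refl (bs-val (vlam t)) D
-- After the β-step the argument is evaluated inside the explicit substitution, weakened by I,
-- so it is factorised under rename (wkρ I) ∘ σ.
factorise rec (app t₁ t₂) {σ} vσ k≤K (bs-β {k = k₁} {I = I} ic D₁ D₂) with es-⇓-split D₂
... | c , i , _ , D₂ᵃ , D₂' , refl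
  with factorise rec t₁ vσ (m+n+1≤o⇒m≤o k₁ k≤K) D₁
     | factorise rec t₂ (Value-rename (wkρ I) ∘ vσ) (m+n≤o⇒m≤o c (<⇒≤ (m+n+1≤o⇒n<o k₁ k≤K)))
         (⇓-resp-≡ (rename-subst (wkρ I) σ t₂) refl D₂ᵃ)
... | factorisation a b n₁ refl ev₁ sev₁ | factorisation a₂ b₂ n₂ refl ev₂ sev₂ =
  Factorisation-app ev₁ ev₂ (cost a b a₂ b₂ i)
    (factorise-redex rec (Fireball-decompose (⇓-Fireball ev₁)) (⇓-Fireball ev₂) vσ
      (≤-by-split (a + a₂) (cost a b a₂ b₂ i) k≤K)
      (bs-β ic sev₁ (es-arg-⇓ (⇓-resp-≡ (sym (rename-subst (wkρ I) σ n₂)) refl sev₂) D₂')))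
  where
  cost : ∀ a b a₂ b₂ i → a + b + (a₂ + b₂ + i) + 1 ≡ a + a₂ + (b + (b₂ + i) + 1)
  cost = solve-∀
factorise rec (app t₁ t₂) vσ k≤K (bs-var {k = k₁} ic D₁ D₂)
  with factorise rec t₁ vσ (m+n≤o⇒m≤o k₁ k≤K) D₁ | factorise rec t₂ vσ (m+n≤o⇒n≤o k₁ k≤K) D₂
... | factorisation a b n₁ refl ev₁ sev₁ | factorisation a₂ b₂ n₂ refl ev₂ sev₂ =
  Factorisation-app ev₁ ev₂ (+-interchange a b a₂ b₂)
    (factorise-redex rec (Fireball-decompose (⇓-Fireball ev₁)) (⇓-Fireball ev₂) vσ
      (≤-by-split (a + a₂) (+-interchange a b a₂ b₂) k≤K) (bs-var ic sev₁ sev₂))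
factorise rec (app t₁ t₂) vσ k≤K (bs-ia {k = k₁} ic ia D₁ D₂)
  with factorise rec t₁ vσ (m+n≤o⇒m≤o k₁ k≤K) D₁ | factorise rec t₂ vσ (m+n≤o⇒n≤o k₁ k≤K) D₂
... | factorisation a b n₁ refl ev₁ sev₁ | factorisation a₂ b₂ n₂ refl ev₂ sev₂ =
  Factorisation-app ev₁ ev₂ (+-interchange a b a₂ b₂)
    (factorise-redex rec (Fireball-decompose (⇓-Fireball ev₁)) (⇓-Fireball ev₂) vσ
      (≤-by-split (a + a₂) (+-interchange a b a₂ b₂) k≤K) (bs-ia ic ia sev₁ sev₂))
factorise rec (es t₁ t₂) vσ k≤K D with es-⇓-split D
... | c , i , _ , D₂ , D' , refl with factorise rec t₂ vσ (m+n≤o⇒m≤o c k≤K) D₂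
... | factorisation a b n₂ refl ev₂ sev₂ =
  Factorisation-es ev₂ (+-assoc a b i)
    (factorise-es-fireball rec t₁ (Fireball-inertOrValue (⇓-Fireball ev₂)) vσ
      (≤-by-split a (+-assoc a b i) k≤K) (es-arg-⇓ sev₂ D'))

factorise-redex (acc rec) (decomposition J ij (head-lam s₀)) {n₂ = n₂} _ vσ k≤K (bs-β {k = c} {I = I} ic D₁ D₂)
  with ⇓-through-ctx J (lam s₀) vσ D₁
... | ce@(ctx-evaluation I' _ vτ c₁ _ _ refl R≡ (bs-val _) _ replay)
  with plug-Value-injective I' I (vlam _) (lam _) (sym R≡)
... | same
  with factorise (rec (m+n+1≤o⇒n<o c k≤K)) (es s₀ (wk J n₂)) vτ ≤-refl
         (⇓-resp-≡ (cong (es _) (sym (subst-τ-wk ce n₂))) refl D₂)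
... | factorisation b d X refl evX sevX =
  factorisation (0 + b + 1) (c₁ + d) (plug J X) (redex-cost c₁ b d)
    (bs-β ij (Fireball-⇓-refl (Fireball-plug ij (fb-val (vlam s₀)))) evX) (replay sevX)
factorise-redex _ (decomposition J _ (head-lam s₀)) _ vσ _ (bs-var {I = I} {x = x} _ D₁ _)
  with ⇓-through-ctx J (lam s₀) vσ D₁
... | ctx-evaluation I' _ _ _ _ _ refl R≡ (bs-val _) _ _
  with plug-Value-injective I' I (vlam _) (var x) (sym R≡)
... | ()
factorise-redex _ (decomposition J _ (head-lam s₀)) _ vσ _ (bs-ia {I = I} _ ia D₁ _)
  with ⇓-through-ctx J (lam s₀) vσ D₁
... | ctx-evaluation I' _ _ _ _ _ refl R≡ (bs-val _) _ _
  with plug-Value-injective I' I (vlam _) (InertApp⇒NotES ia) (sym R≡)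
... | same with ia
... | ()
factorise-redex _ (decomposition J ij (head-var x)) f₂ vσ _ D =
  factorise-stuck-app J (var x) _ vσ
    (bs-var ij (Fireball-⇓-refl (Fireball-plug ij (fb-val (vvar x)))) (Fireball-⇓-refl f₂)) D
factorise-redex _ (decomposition J ij (head-inert a)) f₂ vσ _ D =
  factorise-stuck-app J _ _ vσ
    (bs-ia ij a (Fireball-⇓-refl (Fireball-plug ij (fb-inert (in-app a)))) (Fireball-⇓-refl f₂)) D

factorise-es-fireball rec t₁ (inert {n₂} i₂) vσ k≤K (bs-esi {k = c} {h = h} D₁ D₂ ii)
  with factorise rec t₁ (ValueSubst-exts vσ) (m+n≤o⇒m≤o c k≤K) D₁
... | factorisation a b n₁ refl ev₁ sev₁ =
  factorisation a (b + h) (es n₁ n₂) (+-assoc a b h)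
    (⇓-resp-cost (+-identityʳ a) (bs-esi ev₁ (Inert-⇓-refl i₂) i₂)) (bs-esi sev₁ D₂ ii)
factorise-es-fireball rec t₁ (inert {n₂} i₂) {σ} vσ k≤K (bs-es {k = c} {I = I} {v = w} ic vw D₁ D₂)
  with factorise rec t₁ (ValueSubst-fireSubst vσ I vw) (<⇒≤ (m+n+1≤o⇒n<o c k≤K))
         (⇓-resp-≡ (sym (subst-fireSubst σ I w t₁)) refl D₂)
... | factorisation a b n₁ refl ev₁ sev₁ =
  factorisation a (c + b + 1) (es n₁ n₂) (cost a b c)
    (⇓-resp-cost (+-identityʳ a) (bs-esi ev₁ (Inert-⇓-refl i₂) i₂))
    (bs-es ic vw D₁ (⇓-resp-≡ (subst-fireSubst σ I w n₁) refl sev₁))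
  where
  cost : ∀ a b c → c + (a + b) + 1 ≡ a + (c + b + 1)
  cost = solve-∀
factorise-es-fireball _ _ (value J {v₀} _ vv) vσ _ (bs-esi _ D₂ ii)
  with ⇓-through-ctx J v₀ vσ D₂
... | ctx-evaluation I' _ vτ _ _ _ refl refl v₀-⇓ _ _ with Value-⇓-inv (Value-subst vτ vv) v₀-⇓
... | refl , refl = ⊥-elim (¬Inert-plug-Value I' (Value-subst vτ vv) ii)
factorise-es-fireball (acc rec) t₁ (value J {v₀} ij vv) {σ} vσ k≤K (bs-es {k = c} {I = I} ic vw D₁ D₂)
  with ⇓-through-ctx J v₀ vσ D₁
... | ctx-evaluation I' τ vτ c₁ _ _ refl R≡ v₀-⇓ τ-wk replay with Value-⇓-inv (Value-subst vτ vv) v₀-⇓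
... | refl , refl with plug-Value-injective I' I (Value-subst vτ vv) (Value⇒NotES vw) (sym R≡)
... | same
  with factorise (rec (m+n+1≤o⇒n<o c k≤K)) (rename (ext (wkρ J)) t₁ ⟦ v₀ ⟧) vτ ≤-refl
         (⇓-resp-≡ (sym (subst-renamed-⟦⟧ τ (wkρ J) σ (wkρ I') τ-wk t₁ v₀)) refl D₂)
... | factorisation b d X refl evX sevX =
  factorisation (0 + b + 1) (c₁ + d) (plug J X) (redex-cost c₁ b d)
    (bs-es ij vv (Fireball-⇓-refl (Fireball-plug ij (fb-val vv))) evX) (replay sevX)

proposition11p4 :
    ({n : ℕ} (t t' : Term (suc n)) (v : Term n) → Value v →
      t ⟶ t' → t ⟦ v ⟧ ⟶ t' ⟦ v ⟧)
    ×
    ({n : ℕ} (t : Term (suc n)) (v : Term n) → Value v → (k : ℕ) (nf : Term n) →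
      t ⟦ v ⟧ ⇓[ k ] nf →
      ∃[ k' ] ∃[ nf' ] (t ⇓[ k' ] nf' × k' ≤ k × nf' ⟦ v ⟧ ⇓[ k ∸ k' ] nf))
proposition11p4 = small-step , big-step
  where
  small-step : {n : ℕ} (t t' : Term (suc n)) (v : Term n) → Value v → t ⟶ t' → t ⟦ v ⟧ ⟶ t' ⟦ v ⟧
  small-step t t' v vv = subst-⟶ (ValueSubst-σ₀ vv)

  big-step : {n : ℕ} (t : Term (suc n)) (v : Term n) → Value v → (k : ℕ) (nf : Term n) →
             t ⟦ v ⟧ ⇓[ k ] nf → ∃[ k' ] ∃[ nf' ] (t ⇓[ k' ] nf' × k' ≤ k × nf' ⟦ v ⟧ ⇓[ k ∸ k' ] nf)
  big-step t v vv k nf D with factorise (<-wellFounded k) t (ValueSubst-σ₀ vv) ≤-refl D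
  ... | factorisation k₁ k₂ nf' refl t-⇓ σnf'-⇓ =
    k₁ , nf' , t-⇓ , m≤m+n k₁ k₂ , ⇓-resp-cost (sym (m+n∸m≡n k₁ k₂)) σnf'-⇓
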